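{- Let $\mathfrak{s}$ be a subset of $\mathfrak{u}(T_n)$, and let $\mathfrak{t}$ be a tiling of $T_n \setminus A(\mathfrak{s})$ whose tiles are unit rhombi and unit triangles. Then there exists a reconfiguration $\mathfrak{t}'$ of $\mathfrak{t}$ such that every unit downward triangle that is a tile of $\mathfrak{t}'$ is adjacent from below to a unit upward triangle, i.e., the unit upward triangle of $T_n$ directly above it (sharing its horizontal side) is not part of a unit rhombus of $\mathfrak{t}'$ (it is either a tile of $\mathfrak{t}'$ or an element of $\mathfrak{s}$).
   Context: $T_n$ is a closed equilateral triangle of side length $n$ with horizontal base and apex up, subdivided by lines parallel to its sides at integer distances into unit equilateral triangles; upward-pointing ones are unit upward triangles (set $\mathfrak{u}(T_n)$), downward-pointing ones are unit downward triangles. For $\mathfrak{s} \subseteq \mathfrak{u}(T_n)$, $A(\mathfrak{s})$ is the union of the triangles in $\mathfrak{s}$. A lattice region is a nonempty subset of $T_n$ whose closure is a union of unit triangles; a tiling of a lattice region $R$ is a collection of closed lattice regions with pairwise disjoint interiors whose union is the closure of $R$. A unit rhombus is the union of two unit triangles sharing an edge. If $\mathfrak{t}$ is a tiling of $R$ into unit triangles and unit rhombi, a reconfiguration of $\mathfrak{t}$ is a tiling of $R$ into unit triangles and unit rhombi having the same number of unit upward triangle tiles, of unit downward triangle tiles, and of unit rhombus tiles as $\mathfrak{t}$. -}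

module Defs where

open import Data.Nat using (ℕ; zero; suc; _≤_; _<_; _≡ᵇ_)
open import Data.Bool using (Bool; true; false; _∧_; _∨_)
open import Data.Product using (_×_; _,_; ∃-syntax)
open import Data.Sum using (_⊎_)
open import Data.Empty using (⊥)
open import Data.List using (List; filter; length; [])
open import Data.List.Relation.Unary.All using (All)
open import Data.List.Membership.Propositional using (_∈_)
open import Relation.Binary.PropositionalEquality using (_≡_)
open import Relation.Nullary using (¬_)
open import Relation.Nullary.Decidable using (does)
open import Data.Bool using (T?)

-- Rows are numbered i = 0 .. n-1 from the apex down.
-- Row i contains the unit upward triangles (i , j) with j ≤ i (from left to
-- right) and the unit downward triangles (i , j) with j < i; the downward
-- triangle (i , j) lies between the upward triangles (i , j) (on its left)
-- and (i , j+1) (on its right), and its horizontal (top) side is the bottom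
-- side of the upward triangle (i-1 , j) of the row above.

Pos : Set
Pos = ℕ × ℕ

ValidUp : ℕ → Pos → Set
ValidUp n (i , j) = (j ≤ i) × (i < n)

ValidDown : ℕ → Pos → Set
ValidDown n (i , j) = (j < i) × (i < n)

data Cell : Set where
  up   : Pos → Cell
  down : Pos → Cell

ValidCell : ℕ → Cell → Set
ValidCell n (up p)   = ValidUp n p
ValidCell n (down p) = ValidDown n p

Adjacent : Pos → Pos → Set
Adjacent (i , j) (i' , j') =
  ((i' ≡ i) × (j' ≡ j))            -- d is to the right of u
  ⊎ ((i' ≡ i) × (suc j' ≡ j))      -- d is to the left of u
  ⊎ ((i' ≡ suc i) × (j' ≡ j))      -- d is directly below u (shares u's horizontal side)

data Tile : Set where
  tri   : Cell → Tile
  rhomb : (u d : Pos) → Tile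

ValidTile : ℕ → Tile → Set
ValidTile n (tri c)     = ValidCell n c
ValidTile n (rhomb u d) = ValidUp n u × ValidDown n d × Adjacent u d

_≡ᴾ_ : Pos → Pos → Bool
(i , j) ≡ᴾ (i' , j') = (i ≡ᵇ i') ∧ (j ≡ᵇ j')

covers : Tile → Cell → Bool
covers (tri (up p))   (up q)   = p ≡ᴾ q
covers (tri (down p)) (down q) = p ≡ᴾ q
covers (tri (up _))   (down _) = false
covers (tri (down _)) (up _)   = false
covers (rhomb u d)    (up q)   = u ≡ᴾ q
covers (rhomb u d)    (down q) = d ≡ᴾ q

coverCount : List Tile → Cell → ℕ
coverCount t c = length (filter (λ τ → T? (covers τ c)) t)

InA : List Pos → Cell → Set
InA s (up p)   = p ∈ s
InA s (down _) = ⊥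

IsTiling : ℕ → List Pos → List Tile → Set
IsTiling n s t =
  All (ValidTile n) t ×
  (∀ c → ValidCell n c →
     (InA s c → coverCount t c ≡ 0) × (¬ InA s c → coverCount t c ≡ 1))

isUpTile : Tile → Bool
isUpTile (tri (up _)) = true
isUpTile _ = false

isDownTile : Tile → Bool
isDownTile (tri (down _)) = true
isDownTile _ = false

isRhombTile : Tile → Bool
isRhombTile (rhomb _ _) = true
isRhombTile _ = false

numUp numDown numRhomb : List Tile → ℕ
numUp t    = length (filter (λ τ → T? (isUpTile τ)) t)
numDown t  = length (filter (λ τ → T? (isDownTile τ)) t)
numRhomb t = length (filter (λ τ → T? (isRhombTile τ)) t)

IsReconfiguration : ℕ → List Pos → List Tile → List Tile → Set
IsReconfiguration n s t t' =
  IsTiling n s t' × (numUp t' ≡ numUp t) × (numDown t' ≡ numDown t) × (numRhomb t' ≡ numRhomb t)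

DownTilesCovered : List Tile → Set
DownTilesCovered t' =
  ∀ i j → tri (down (suc i , j)) ∈ t' → ∀ d → ¬ (rhomb (i , j) d ∈ t')

-- Weight a tiling by the sum of the row indices of its downward triangle
-- tiles.  If a downward tile (i+1 , j) sits under the upward half (i , j) of a
-- rhombus, the downward half of that rhombus cannot be (i+1 , j) itself, so it
-- is one of the two downward triangles of row i next to (i , j).  Re-pairing
-- (i , j) with (i+1 , j) and leaving the row-i downward triangle as a tile
-- keeps every cell covered once and every tile count unchanged, and lowers the
-- weight by one; iterating until no downward tile is blocked terminates.
module Submission where

open import Defs
open import Data.Nat using (ℕ; suc; _+_; _<_; _≟_)
open import Data.Nat.Properties using (≡⇒≡ᵇ; n<1+n)
open import Data.Nat.Induction using (<-wellFounded)
open import Data.Nat.ListAction using (sum)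
open import Data.Nat.ListAction.Properties using (sum-↭)
open import Data.Bool using (Bool; T; T?)
open import Data.Bool.Properties using (T-∧)
open import Data.List using (List; []; _∷_; _++_; filter; length; map)
open import Data.List.Properties using (filter-++; filter-accept; filter-reject; length-++)
open import Data.List.Relation.Unary.All using (All; _∷_)
open import Data.List.Relation.Unary.Any using (Any; here; there; any?)
open import Data.List.Membership.Propositional using (_∈_; find; lose)
open import Data.List.Membership.Propositional.Properties using (∈-∃++)
open import Data.List.Relation.Binary.Permutation.Propositional
  using (_↭_; prep; swap; ↭-refl; ↭-sym; ↭-trans)
open import Data.List.Relation.Binary.Permutation.Propositional.Properties
  using (shift; ∈-resp-↭; All-resp-↭; filter-↭; ↭-length; map⁺)
open import Data.Product using (∃-syntax; _×_; _,_; proj₁; proj₂)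
import Data.Product as Product
open import Data.Product.Properties using (≡-dec)
open import Data.Sum using (inj₁; inj₂)
open import Data.Empty using (⊥; ⊥-elim)
open import Function using (_∘_; id; Equivalence)
open import Induction.WellFounded using (Acc; acc)
open import Relation.Nullary using (¬_; Dec; yes; no; contradiction)
open import Relation.Binary.PropositionalEquality
  using (_≡_; _≢_; refl; sym; trans; cong; subst)

private
  variable
    A : Set
    x y : A
    xs ys zs : List A

count : (A → Bool) → List A → ℕ
count b = length ∘ filter (T? ∘ b)

count-↭ : (b : A → Bool) → xs ↭ ys → count b xs ≡ count b ys
count-↭ b = ↭-length ∘ filter-↭ (T? ∘ b)

count-++ : (b : A → Bool) (xs ys : List A) → count b (xs ++ ys) ≡ count b xs + count b ys
count-++ b xs ys = trans (cong length (filter-++ (T? ∘ b) xs ys)) (length-++ (filter (T? ∘ b) xs))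

count-++-congˡ : (b : A → Bool) (zs : List A) →
  count b xs ≡ count b ys → count b (xs ++ zs) ≡ count b (ys ++ zs)
count-++-congˡ {xs = xs} {ys} b zs eq = begin
  count b (xs ++ zs)        ≡⟨ count-++ b xs zs ⟩
  count b xs + count b zs   ≡⟨ cong (_+ count b zs) eq ⟩
  count b ys + count b zs   ≡⟨ count-++ b ys zs ⟨
  count b (ys ++ zs)        ∎
  where open Relation.Binary.PropositionalEquality.≡-Reasoning

count-accept : (b : A → Bool) → T (b x) → count b (x ∷ xs) ≡ suc (count b xs)
count-accept b bx = cong length (filter-accept (T? ∘ b) bx)

count-reject : (b : A → Bool) → ¬ T (b x) → count b (x ∷ xs) ≡ count b xs
count-reject b ¬bx = cong length (filter-reject (T? ∘ b) ¬bx)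

count-map : (b : A → Bool) (xs : List A) → count b xs ≡ count id (map b xs)
count-map b []       = refl
count-map b (x ∷ xs) with T? (b x)
... | yes bx = trans (count-accept b bx)
                 (trans (cong suc (count-map b xs)) (sym (count-accept id bx)))
... | no ¬bx = trans (count-reject b ¬bx)
                 (trans (count-map b xs) (sym (count-reject id ¬bx)))

∈⇒↭∷ : x ∈ xs → ∃[ ys ] (xs ↭ x ∷ ys)
∈⇒↭∷ x∈xs with ys , zs , refl ← ∈-∃++ x∈xs = ys ++ zs , shift _ ys zs

∈×∈⇒↭∷∷ : x ∈ xs → y ∈ xs → y ≢ x → ∃[ zs ] (xs ↭ x ∷ y ∷ zs)
∈×∈⇒↭∷∷ x∈xs y∈xs y≢x with ys , xs↭x∷ys ← ∈⇒↭∷ x∈xs with ∈-resp-↭ xs↭x∷ys y∈xs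
... | here y≡x = contradiction y≡x y≢x
... | there y∈ys with zs , ys↭y∷zs ← ∈⇒↭∷ y∈ys = zs , ↭-trans xs↭x∷ys (prep _ ys↭y∷zs)

≡ᴾ-refl : ∀ p → T (p ≡ᴾ p)
≡ᴾ-refl (i , j) = Equivalence.from T-∧ (≡⇒≡ᵇ i i refl , ≡⇒≡ᵇ j j refl)

record SameCounts (t t' : List Tile) : Set where
  constructor same-counts
  field
    coverCount-eq : ∀ c → coverCount t' c ≡ coverCount t c
    numUp-eq      : numUp t' ≡ numUp t
    numDown-eq    : numDown t' ≡ numDown t
    numRhomb-eq   : numRhomb t' ≡ numRhomb t

↭⇒SameCounts : ∀ {t t'} → t ↭ t' → SameCounts t t'
↭⇒SameCounts t↭t' = same-counts
  (λ c → count-↭ (λ τ → covers τ c) t'↭t)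
  (count-↭ isUpTile t'↭t) (count-↭ isDownTile t'↭t) (count-↭ isRhombTile t'↭t)
  where t'↭t = ↭-sym t↭t'

SameCounts-trans : ∀ {t₁ t₂ t₃} → SameCounts t₁ t₂ → SameCounts t₂ t₃ → SameCounts t₁ t₃
SameCounts-trans (same-counts c₁ u₁ d₁ r₁) (same-counts c₂ u₂ d₂ r₂) =
  same-counts (λ c → trans (c₂ c) (c₁ c)) (trans u₂ u₁) (trans d₂ d₁) (trans r₂ r₁)

SameCounts-++ʳ : ∀ {t t'} r → SameCounts t t' → SameCounts (t ++ r) (t' ++ r)
SameCounts-++ʳ {t} {t'} r (same-counts c u d ρ) = same-counts
  (λ c' → congʳ (λ τ → covers τ c') (c c'))
  (congʳ isUpTile u) (congʳ isDownTile d) (congʳ isRhombTile ρ)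
  where
  congʳ : (b : Tile → Bool) → count b t' ≡ count b t → count b (t' ++ r) ≡ count b (t ++ r)
  congʳ b = count-++-congˡ {xs = t'} {ys = t} b r

rhomb-exchange-SameCounts : ∀ u d d' →
  SameCounts (rhomb u d ∷ tri (down d') ∷ []) (rhomb u d' ∷ tri (down d) ∷ [])
rhomb-exchange-SameCounts u d d' = same-counts covers-equal refl refl refl
  where
  open Relation.Binary.PropositionalEquality.≡-Reasoning
  before = rhomb u d ∷ tri (down d') ∷ []
  after  = rhomb u d' ∷ tri (down d) ∷ []
  covers-equal : ∀ c → coverCount after c ≡ coverCount before c
  covers-equal (up q)   = trans (count-map b after) (sym (count-map b before))
    where b = λ τ → covers τ (up q)
  covers-equal (down q) = begin
    count b after           ≡⟨ count-map b after ⟩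
    count id (map b after)  ≡⟨ count-↭ {xs = map b after} id (swap _ _ ↭-refl) ⟩
    count id (map b before) ≡⟨ count-map b before ⟨
    count b before          ∎
    where b = λ τ → covers τ (down q)

downRow : Tile → ℕ
downRow (tri (down (i , _))) = i
downRow _                    = 0

depth : List Tile → ℕ
depth = sum ∘ map downRow

depth-↭ : ∀ {t t'} → t ↭ t' → depth t ≡ depth t'
depth-↭ = sum-↭ ∘ map⁺ downRow

data Blocks : Tile → Tile → Set where
  blocks : ∀ i j d → Blocks (rhomb (i , j) d) (tri (down (suc i , j)))

blocks? : ∀ τ σ → Dec (Blocks τ σ)
blocks? (rhomb u d) (tri (down (suc i , j))) with ≡-dec _≟_ _≟_ u (i , j)
... | yes refl = yes (blocks i j d)
... | no u≢ij  = no λ { (blocks _ _ _) → u≢ij refl }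
blocks? (tri _)     _                        = no λ ()
blocks? (rhomb _ _) (rhomb _ _)              = no λ ()
blocks? (rhomb _ _) (tri (up _))             = no λ ()
blocks? (rhomb _ _) (tri (down (0 , _)))     = no λ ()

Blocked : List Tile → Set
Blocked t = Any (λ σ → Any (λ τ → Blocks τ σ) t) t

blocked? : ∀ t → Dec (Blocked t)
blocked? t = any? (λ σ → any? (λ τ → blocks? τ σ) t) t

¬Blocked⇒DownTilesCovered : ∀ t → ¬ Blocked t → DownTilesCovered t
¬Blocked⇒DownTilesCovered t ¬blocked i j σ∈t d τ∈t = ¬blocked (lose σ∈t (lose τ∈t (blocks i j d)))

module _ {n : ℕ} {s : List Pos} where

  IsReconfiguration-refl : ∀ {t} → IsTiling n s t → IsReconfiguration n s t t
  IsReconfiguration-refl til = til , refl , refl , refl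

  IsReconfiguration-trans : ∀ {t₁ t₂ t₃} →
    IsReconfiguration n s t₁ t₂ → IsReconfiguration n s t₂ t₃ → IsReconfiguration n s t₁ t₃
  IsReconfiguration-trans (_ , u₁ , d₁ , r₁) (til₃ , u₂ , d₂ , r₂) =
    til₃ , trans u₂ u₁ , trans d₂ d₁ , trans r₂ r₁

  SameCounts⇒IsReconfiguration : ∀ {t t'} →
    IsTiling n s t → All (ValidTile n) t' → SameCounts t t' → IsReconfiguration n s t t'
  SameCounts⇒IsReconfiguration (_ , covered) valid' (same-counts c u d r) =
    (valid' , λ cell v → Product.map (trans (c cell) ∘_) (trans (c cell) ∘_) (covered cell v)) ,
    u , d , r

  down-cell-covered-once : ∀ {t τ σ r p} → IsTiling n s t → t ↭ τ ∷ σ ∷ r → ValidDown n p →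
    T (covers τ (down p)) → T (covers σ (down p)) → ⊥
  down-cell-covered-once {t} {τ} {σ} {r} {p} (_ , covered) t↭ vp τp σp =
    contradiction (trans (sym once) twice) λ ()
    where
    b = λ τ → covers τ (down p)
    once : coverCount t (down p) ≡ 1
    once = proj₂ (covered (down p) vp) λ ()
    twice : coverCount t (down p) ≡ suc (suc (count b r))
    twice = trans (count-↭ b t↭)
      (trans (count-accept {x = τ} {σ ∷ r} b τp) (cong suc (count-accept {x = σ} {r} b σp)))

  unblock-in-row : ∀ {t i j k r} → IsTiling n s t →
    t ↭ rhomb (i , j) (i , k) ∷ tri (down (suc i , j)) ∷ r →
    ValidUp n (i , j) → ValidDown n (i , k) → ValidDown n (suc i , j) → All (ValidTile n) r →
    ∃[ t' ] (IsReconfiguration n s t t' × depth t' < depth t)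
  unblock-in-row {i = i} {j} {k} {r} til t↭ vu vk vσ vr =
    rhomb (i , j) (suc i , j) ∷ tri (down (i , k)) ∷ r ,
    SameCounts⇒IsReconfiguration til ((vu , vσ , inj₂ (inj₂ (refl , refl))) ∷ vk ∷ vr)
      (SameCounts-trans (↭⇒SameCounts t↭)
        (SameCounts-++ʳ r (rhomb-exchange-SameCounts (i , j) (i , k) (suc i , j)))) ,
    subst (i + depth r <_) (sym (depth-↭ t↭)) (n<1+n (i + depth r))

  unblock-↭ : ∀ {t i j a b r} → IsTiling n s t →
    t ↭ rhomb (i , j) (a , b) ∷ tri (down (suc i , j)) ∷ r →
    ∃[ t' ] (IsReconfiguration n s t t' × depth t' < depth t)
  unblock-↭ {a = a} {b} til t↭ with All-resp-↭ t↭ (proj₁ til)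
  ... | (vu , vd , inj₁ (refl , refl)) ∷ vσ ∷ vr         = unblock-in-row til t↭ vu vd vσ vr
  ... | (vu , vd , inj₂ (inj₁ (refl , refl))) ∷ vσ ∷ vr  = unblock-in-row til t↭ vu vd vσ vr
  ... | (_ , _ , inj₂ (inj₂ (refl , refl))) ∷ vσ ∷ _     =
    ⊥-elim (down-cell-covered-once til t↭ vσ (≡ᴾ-refl (a , b)) (≡ᴾ-refl (a , b)))

  unblock : ∀ {t τ σ} → IsTiling n s t → τ ∈ t → σ ∈ t → Blocks τ σ →
    ∃[ t' ] (IsReconfiguration n s t t' × depth t' < depth t)
  unblock til τ∈t σ∈t (blocks i j d) with r , t↭ ← ∈×∈⇒↭∷∷ τ∈t σ∈t (λ ()) = unblock-↭ til t↭

  reconfigure : ∀ t → Acc _<_ (depth t) → IsTiling n s t →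
    ∃[ t' ] (IsReconfiguration n s t t' × DownTilesCovered t')
  reconfigure t (acc smaller) til with blocked? t
  ... | no ¬blocked = t , IsReconfiguration-refl {t} til , ¬Blocked⇒DownTilesCovered t ¬blocked
  ... | yes blocked =
    let σ , σ∈t , σ-blocked = find blocked
        τ , τ∈t , τ-blocks-σ = find σ-blocked
        t₁ , t→t₁ , deeper = unblock til τ∈t σ∈t τ-blocks-σ
        t₂ , t₁→t₂ , covered = reconfigure t₁ (smaller deeper) (proj₁ t→t₁)
    in t₂ , IsReconfiguration-trans {t} {t₁} {t₂} t→t₁ t₁→t₂ , covered

lemma4p1 : (n : ℕ) (s : List Pos) → All (ValidUp n) s →
    (t : List Tile) → IsTiling n s t →
    ∃[ t' ] (IsReconfiguration n s t t' × DownTilesCovered t')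
lemma4p1 n s _ t = reconfigure t (<-wellFounded (depth t))
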